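{- Let $W$ be a web world and $D,D'\in W$. Then $M^{(W)}(x)_{D,D'}=M^{(W)}(x)_{\mathrm{flip}(D),\mathrm{flip}(D')}$.
   Context: For integers $a\le b$, $[a,b]=\{a,\ldots,b\}$. A web diagram on $n$ pegs with $m$ edges is a set $D=\{e_j=(a_j,b_j,c_j,d_j):1\le j\le m\}$ of 4-tuples of positive integers (edges distinguished by index $j$) with $1\le a_j<b_j\le n$, such that for each peg $i$, letting $p_i(D)$ be the number of $j$ with $a_j=i$ or $b_j=i$, the sets $\{c_j:a_j=i\}$ and $\{d_j:b_j=i\}$ are disjoint with union $[1,p_i(D)]$. The sum is $D\oplus D'=D\cup\{(x',y',a'+p_{x'}(D),b'+p_{y'}(D)):(x',y',a',b')\in D'\}$. The web world $W(D)$ is the set of all web diagrams obtained from $D$ by permuting the heights of the vertices on each peg. The flip of $D$ (turning it upside down) is $\mathrm{flip}(D)=\{(a_j,b_j,p_{a_j}(D)+1-c_j,p_{b_j}(D)+1-d_j):1\le j\le m\}$, which lies in $W(D)$. An $\ell$-colouring of $D$ is a surjection $\alpha$ from the edges of $D$ onto $[1,\ell]$; $D_\alpha(i)$ is the set of edges of colour $i$; $\mathrm{rel}$ relabels heights on each peg by $1,2,\ldots$ preserving order; the reconstruction is $\alpha(D)=\mathrm{rel}(D_\alpha(1))\oplus\cdots\oplus\mathrm{rel}(D_\alpha(\ell))$. For $D_1,D_2\in W$, $f(D_1,D_2,\ell)$ is the number of $\ell$-colourings $\alpha$ of $D_1$ with $\alpha(D_1)=D_2$, and the web-colouring matrix is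 $M^{(W)}(x)_{D_1,D_2}=\sum_{\ell\ge1}x^\ell f(D_1,D_2,\ell)$. -}

module Defs where

open import Data.Nat using (ℕ; zero; suc; _+_; _∸_; _≤_; _<_; _≟_; _<ᵇ_; _≡ᵇ_)
open import Data.Bool using (Bool; true; false; _∧_; _∨_)
open import Data.Product using (Σ; ∃; _×_; _,_; proj₁; proj₂)
open import Data.Sum using (_⊎_)
open import Data.List using (List; []; _∷_; _++_; map; length; filterᵇ; upTo; concatMap; foldl; zip)
open import Data.Bool.ListAction using (all; any)
open import Data.List.Relation.Unary.Any using (Any)
open import Data.List.Membership.Propositional using (_∈_)
open import Data.List.Relation.Binary.Permutation.Propositional using (_↭_)
open import Relation.Binary.PropositionalEquality using (_≡_)
open import Relation.Nullary using (¬_)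

-- An edge is a 4-tuple (a , b , c , d): from peg a at height c to peg b
-- at height d.  A diagram is a list of edges; the position in the list
-- is the edge index j (edges are distinguished by index).

Edge : Set
Edge = ℕ × ℕ × ℕ × ℕ

src tgt ht₁ ht₂ : Edge → ℕ
src (a , b , c , d) = a
tgt (a , b , c , d) = b
ht₁ (a , b , c , d) = c
ht₂ (a , b , c , d) = d

Diagram : Set
Diagram = List Edge

p : ℕ → Diagram → ℕ
p i D = length (filterᵇ (λ e → (src e ≡ᵇ i) ∨ (tgt e ≡ᵇ i)) D)

IsWebDiagram : ℕ → Diagram → Set
IsWebDiagram n D =
  (∀ e → e ∈ D → (1 ≤ src e) × (src e < tgt e) × (tgt e ≤ n) × (1 ≤ ht₁ e) × (1 ≤ ht₂ e))
  × (∀ i → 1 ≤ i → i ≤ n → ∀ h →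
       ((Any (λ e → src e ≡ i × ht₁ e ≡ h) D ⊎ Any (λ e → tgt e ≡ i × ht₂ e ≡ h) D)
          → (1 ≤ h × h ≤ p i D))
     × ((1 ≤ h × h ≤ p i D)
          → (Any (λ e → src e ≡ i × ht₁ e ≡ h) D ⊎ Any (λ e → tgt e ≡ i × ht₂ e ≡ h) D))
     × ¬ (Any (λ e → src e ≡ i × ht₁ e ≡ h) D × Any (λ e → tgt e ≡ i × ht₂ e ≡ h) D))

PermutesHeights : Diagram → (ℕ → ℕ → ℕ) → Set
PermutesHeights D σ = ∀ i →
    (∀ h → 1 ≤ h → h ≤ p i D → 1 ≤ σ i h × σ i h ≤ p i D)
  × (∀ h h' → 1 ≤ h → h ≤ p i D → 1 ≤ h' → h' ≤ p i D → σ i h ≡ σ i h' → h ≡ h')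
  × (∀ k → 1 ≤ k → k ≤ p i D → ∃ λ h → 1 ≤ h × h ≤ p i D × σ i h ≡ k)

relabelHeights : (ℕ → ℕ → ℕ) → Diagram → Diagram
relabelHeights σ = map (λ { (a , b , c , d) → (a , b , σ a c , σ b d) })

InWebWorld : ℕ → Diagram → Diagram → Set
InWebWorld n D D' =
  IsWebDiagram n D' × ∃ λ σ → PermutesHeights D σ × (D' ↭ relabelHeights σ D)

flip : Diagram → Diagram
flip D = map (λ { (a , b , c , d) → (a , b , suc (p a D) ∸ c , suc (p b D) ∸ d) }) D

_⊕_ : Diagram → Diagram → Diagram
D ⊕ D' = D ++ map (λ { (x , y , a , b) → (x , y , a + p x D , b + p y D) }) D'

heightsOn : ℕ → Diagram → List ℕ
heightsOn i S = map ht₁ (filterᵇ (λ e → src e ≡ᵇ i) S) ++ map ht₂ (filterᵇ (λ e → tgt e ≡ᵇ i) S)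

rank : ℕ → ℕ → Diagram → ℕ
rank i h S = suc (length (filterᵇ (λ h' → h' <ᵇ h) (heightsOn i S)))

rel : Diagram → Diagram
rel S = map (λ { (a , b , c , d) → (a , b , rank a c S , rank b d S) }) S

-- Colourings. A colouring of D is a list α of colours, α_j being the
-- colour of the j-th edge of D.

colourings : ℕ → ℕ → List (List ℕ)
colourings ℓ zero = [] ∷ []
colourings ℓ (suc m) = concatMap (λ c → map (c ∷_) (colourings ℓ m)) (map suc (upTo ℓ))

isOnto : ℕ → List ℕ → Bool
isOnto ℓ α = all (λ k → any (λ c → c ≡ᵇ k) α) (map suc (upTo ℓ))

colourClass : Diagram → List ℕ → ℕ → Diagram
colourClass D α i = map proj₁ (filterᵇ (λ eα → proj₂ eα ≡ᵇ i) (zip D α))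

reconstruct : ℕ → Diagram → List ℕ → Diagram
reconstruct ℓ D α = foldl (λ acc i → acc ⊕ rel (colourClass D α i)) [] (map suc (upTo ℓ))

_≡ᴱ_ : Edge → Edge → Bool
(a , b , c , d) ≡ᴱ (a' , b' , c' , d') = (a ≡ᵇ a') ∧ (b ≡ᵇ b') ∧ (c ≡ᵇ c') ∧ (d ≡ᵇ d')

sameSet : Diagram → Diagram → Bool
sameSet X Y = all (λ e → any (e ≡ᴱ_) Y) X ∧ all (λ e → any (e ≡ᴱ_) X) Y

f : Diagram → Diagram → ℕ → ℕ
f D₁ D₂ ℓ = length (filterᵇ (λ α → isOnto ℓ α ∧ sameSet (reconstruct ℓ D₁ α) D₂)
                            (colourings ℓ (length D₁)))

-- coefficient of x^ℓ in M^(W)(x)_{D₁,D₂} = Σ_{ℓ≥1} x^ℓ f(D₁,D₂,ℓ)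
webMatrixCoeff : Diagram → Diagram → ℕ → ℕ
webMatrixCoeff D₁ D₂ zero = 0
webMatrixCoeff D₁ D₂ (suc ℓ) = f D₁ D₂ (suc ℓ)

module Submission where

-- Reversing the colours, c ↦ ℓ + 1 − c, permutes the ℓ-colourings of a diagram and preserves surjectivity.
-- Turning a web diagram D upside down reverses the order of the heights on every peg, so it commutes with
-- rel on each colour class, while flip (A ⊕ B) is flip B ⊕ flip A up to the order of the edges. Hence the
-- reconstruction of flip D under the reversed colouring is the flip of the reconstruction of D under the
-- original one, and as flipping is injective on diagrams with heights in [1, p], α(D) = D' holds exactly
-- when the reversed colouring turns flip D into flip D'.

open import Defs
open import Data.Bool using (Bool; true; false; _∧_; _∨_; T; if_then_else_)
open import Data.Bool.ListAction using (and; all; any)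
import Data.Bool.Properties as Boolₚ
open import Data.Empty using (⊥; ⊥-elim)
open import Data.List using (List; []; _∷_; _++_; map; length; filterᵇ; upTo; foldl; reverse; _∷ʳ_; concat)
import Data.List.Properties as Listₚ
open import Data.List.Membership.Propositional using (_∈_; find; lose)
open import Data.List.Membership.Propositional.Properties
  using (∈-map⁺; ∈-map⁻; ∈-++⁺ˡ; ∈-++⁺ʳ; ∈-++⁻; ∈-filter⁺; ∈-filter⁻; ∈-concat⁻′)
open import Data.List.Relation.Unary.All as All using (All; []; _∷_; tabulate; universal)
open import Data.List.Relation.Unary.All.Properties using (all⁺; all⁻) renaming (map⁺ to All-map⁺)
open import Data.List.Relation.Unary.Any as Any using (here; there)
open import Data.List.Relation.Unary.Any.Properties using (any⁺; any⁻)
open import Data.List.Relation.Binary.BagAndSetEquality using (_∼[_]_; set)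
open import Data.List.Relation.Binary.Permutation.Propositional
  using (_↭_; ↭-refl; ↭-sym; ↭-trans; ↭-reflexive; module PermutationReasoning)
import Data.List.Relation.Binary.Permutation.Propositional.Properties as ↭ₚ
open import Data.List.Relation.Binary.Sublist.Propositional as Sublist using (_⊆_)
import Data.List.Relation.Binary.Sublist.Propositional.Properties as ⊆ₚ
open import Data.Nat using (ℕ; zero; suc; _+_; _∸_; _≤_; _<_; _≡ᵇ_; _<ᵇ_; z≤n; s≤s)
open import Data.Nat.Properties
open import Data.Nat.ListAction using (sum)
open import Data.Nat.Solver using (module +-*-Solver)
open import Data.Product using (∃; _×_; _,_; proj₁; proj₂; map₂)
open import Data.Sum using (_⊎_; inj₁; inj₂)
open import Data.Unit using (tt)
open import Function using (_∘_; Equivalence; mk⇔)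
open import Relation.Binary.Definitions using (tri<; tri≈; tri>)
open import Relation.Binary.PropositionalEquality
open import Relation.Nullary using (¬_)
open import Relation.Nullary.Decidable using (T?)

T⇒≡true : ∀ {b} → T b → b ≡ true
T⇒≡true = Equivalence.to Boolₚ.T-≡

¬T⇒≡false : ∀ {b} → ¬ T b → b ≡ false
¬T⇒≡false {false} _ = refl
¬T⇒≡false {true} ¬t = ⊥-elim (¬t tt)

T⇔T⇒≡ : ∀ {b b'} → (T b → T b') → (T b' → T b) → b ≡ b'
T⇔T⇒≡ {false} {false} _ _ = refl
T⇔T⇒≡ {false} {true} _ from = ⊥-elim (from tt)
T⇔T⇒≡ {true} {false} to _ = ⊥-elim (to tt)
T⇔T⇒≡ {true} {true} _ _ = refl

≡ᵇ-refl : ∀ n → (n ≡ᵇ n) ≡ true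
≡ᵇ-refl n = T⇒≡true (≡⇒≡ᵇ n n refl)

≡ᵇ-true⇒≡ : ∀ m n → (m ≡ᵇ n) ≡ true → m ≡ n
≡ᵇ-true⇒≡ m n eq = ≡ᵇ⇒≡ m n (Equivalence.from Boolₚ.T-≡ eq)

≢⇒≡ᵇ-false : ∀ m n → m ≢ n → (m ≡ᵇ n) ≡ false
≢⇒≡ᵇ-false m n m≢n = ¬T⇒≡false (m≢n ∘ ≡ᵇ⇒≡ m n)

<⇒<ᵇ-true : ∀ {m n} → m < n → (m <ᵇ n) ≡ true
<⇒<ᵇ-true = T⇒≡true ∘ <⇒<ᵇ

≥⇒<ᵇ-false : ∀ m n → n ≤ m → (m <ᵇ n) ≡ false
≥⇒<ᵇ-false m n n≤m = ¬T⇒≡false (λ t → <⇒≱ (<ᵇ⇒< m n t) n≤m)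

𝟙 : Bool → ℕ
𝟙 true = 1
𝟙 false = 0

count : {A : Set} → (A → Bool) → List A → ℕ
count P xs = length (filterᵇ P xs)

module _ {A : Set} (P : A → Bool) where

  count-∷ : ∀ x xs → count P (x ∷ xs) ≡ 𝟙 (P x) + count P xs
  count-∷ x xs with P x
  ... | true = refl
  ... | false = refl

  count-++ : ∀ xs ys → count P (xs ++ ys) ≡ count P xs + count P ys
  count-++ xs ys = trans (cong length (Listₚ.filter-++ (T? ∘ P) xs ys)) (Listₚ.length-++ (filterᵇ P xs))

  count-↭ : ∀ {xs ys} → xs ↭ ys → count P xs ≡ count P ys
  count-↭ π = ↭ₚ.↭-length (↭ₚ.filter-↭ (T? ∘ P) π)

  count-mono-⊆ : ∀ {xs ys} → xs ⊆ ys → count P xs ≤ count P ys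
  count-mono-⊆ τ = ⊆ₚ.length-mono-≤ (⊆ₚ.filter⁺ (T? ∘ P) (T? ∘ P) (λ { refl t → t }) τ)

  count-pos : ∀ {x xs} → x ∈ xs → P x ≡ true → 1 ≤ count P xs
  count-pos x∈ Px = Listₚ.filter-some (T? ∘ P) (lose x∈ (Equivalence.from Boolₚ.T-≡ Px))

  count<length : ∀ {x xs} → x ∈ xs → P x ≡ false → count P xs < length xs
  count<length x∈ Px = Listₚ.filter-notAll (T? ∘ P) _ (lose x∈ (λ t → subst T Px t))

  count-none : ∀ xs → (∀ x → x ∈ xs → P x ≡ false) → count P xs ≡ 0
  count-none xs none = cong length (Listₚ.filter-none (T? ∘ P) (tabulate (λ x∈ t → subst T (none _ x∈) t)))

count-cong : {A : Set} (P Q : A → Bool) → ∀ xs → (∀ x → x ∈ xs → P x ≡ Q x) → count P xs ≡ count Q xs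
count-cong P Q [] _ = refl
count-cong P Q (x ∷ xs) P≡Q = begin
  count P (x ∷ xs)     ≡⟨ count-∷ P x xs ⟩
  𝟙 (P x) + count P xs ≡⟨ cong₂ _+_ (cong 𝟙 (P≡Q x (here refl))) (count-cong P Q xs (λ y → P≡Q y ∘ there)) ⟩
  𝟙 (Q x) + count Q xs ≡⟨ count-∷ Q x xs ⟨
  count Q (x ∷ xs)     ∎
  where open ≡-Reasoning

count-map : {A B : Set} (P : B → Bool) (g : A → B) → ∀ xs → count P (map g xs) ≡ count (P ∘ g) xs
count-map P g [] = refl
count-map P g (x ∷ xs) with P (g x)
... | true = cong suc (count-map P g xs)
... | false = count-map P g xs

count-∨ : {A : Set} (P Q : A → Bool) → ∀ xs → (∀ x → x ∈ xs → P x ≡ true → Q x ≡ true → ⊥) →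
  count P xs + count Q xs ≡ count (λ x → P x ∨ Q x) xs
count-∨ P Q [] _ = refl
count-∨ P Q (x ∷ xs) disjoint
  rewrite count-∷ P x xs | count-∷ Q x xs | count-∷ (λ x → P x ∨ Q x) x xs
  with P x in Px | Q x in Qx | count-∨ P Q xs (λ y → disjoint y ∘ there)
... | true | true | _ = ⊥-elim (disjoint x (here refl) Px Qx)
... | true | false | ih = cong suc ih
... | false | true | ih = trans (+-suc (count P xs) (count Q xs)) (cong suc ih)
... | false | false | ih = ih

sum-map-0 : {A : Set} → ∀ (L : List A) → sum (map (λ _ → 0) L) ≡ 0
sum-map-0 [] = refl
sum-map-0 (x ∷ L) = sum-map-0 L

sum-map-+ : {A : Set} → ∀ L (f g : A → ℕ) → sum (map (λ i → f i + g i) L) ≡ sum (map f L) + sum (map g L)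
sum-map-+ [] f g = refl
sum-map-+ (x ∷ L) f g = trans (cong (f x + g x +_) (sum-map-+ L f g))
  (interchange (f x) (g x) (sum (map f L)) (sum (map g L)))
  where
  interchange : ∀ a b c d → (a + b) + (c + d) ≡ (a + c) + (b + d)
  interchange = solve 4 (λ a b c d → (a :+ b) :+ (c :+ d) := (a :+ c) :+ (b :+ d)) refl
    where open +-*-Solver

sum-map-𝟙 : {A : Set} → ∀ L (P : A → Bool) → sum (map (𝟙 ∘ P) L) ≡ count P L
sum-map-𝟙 [] P = refl
sum-map-𝟙 (x ∷ L) P = trans (cong (𝟙 (P x) +_) (sum-map-𝟙 L P)) (sym (count-∷ P x L))

-- Relabelling heights and summing diagrams

pegSize : Diagram → ℕ → ℕ
pegSize D i = p i D

incident : ℕ → Edge → Bool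
incident i e = (src e ≡ᵇ i) ∨ (tgt e ≡ᵇ i)

-- rel, flip and the shift in _⊕_ all map relabelEdge over a diagram; for instance flip D and
-- map (flipWith (pegSize D)) D are definitionally equal, which the statements below rely on.
relabelEdge : (ℕ → ℕ → ℕ) → Edge → Edge
relabelEdge σ (a , b , c , d) = (a , b , σ a c , σ b d)

flipWith : (ℕ → ℕ) → Edge → Edge
flipWith P = relabelEdge (λ a c → suc (P a) ∸ c)

shiftBy : (ℕ → ℕ) → Edge → Edge
shiftBy P = relabelEdge (λ a c → c + P a)

relabelEdge-cong : ∀ σ τ e → σ (src e) (ht₁ e) ≡ τ (src e) (ht₁ e) → σ (tgt e) (ht₂ e) ≡ τ (tgt e) (ht₂ e) →
  relabelEdge σ e ≡ relabelEdge τ e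
relabelEdge-cong σ τ (a , b , c , d) = cong₂ (λ u v → (a , b , u , v))

map-relabelEdge-cong : ∀ σ τ → (∀ a c → σ a c ≡ τ a c) → ∀ X → map (relabelEdge σ) X ≡ map (relabelEdge τ) X
map-relabelEdge-cong σ τ σ≡τ = Listₚ.map-cong (λ e → relabelEdge-cong σ τ e (σ≡τ _ _) (σ≡τ _ _))

p-relabel : ∀ i σ X → p i (map (relabelEdge σ) X) ≡ p i X
p-relabel i σ = count-map (incident i) (relabelEdge σ)

flip-pegSize : ∀ {P} X → (∀ a → p a X ≡ P a) → flip X ≡ map (flipWith P) X
flip-pegSize {P} X p≡P =
  map-relabelEdge-cong (λ a c → suc (p a X) ∸ c) (λ a c → suc (P a) ∸ c)
                       (λ a c → cong (λ z → suc z ∸ c) (p≡P a)) X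

p-webWorld : ∀ {n D₀ D} → InWebWorld n D₀ D → ∀ i → p i D ≡ p i D₀
p-webWorld {D₀ = D₀} (_ , σ , _ , D↭) i = trans (count-↭ (incident i) D↭) (p-relabel i σ D₀)

p-⊕ : ∀ i X Y → p i (X ⊕ Y) ≡ p i X + p i Y
p-⊕ i X Y = trans (count-++ (incident i) X _) (cong (p i X +_) (p-relabel i _ Y))

⊕-identityˡ : ∀ X → [] ⊕ X ≡ X
⊕-identityˡ X =
  trans (map-relabelEdge-cong (λ a c → c + p a []) (λ _ c → c) (λ _ → +-identityʳ) X) (Listₚ.map-id X)

⊕-assoc : ∀ A B C → (A ⊕ B) ⊕ C ≡ A ⊕ (B ⊕ C)
⊕-assoc A B C = begin
  (A ++ map (shiftBy (pegSize A)) B) ++ map (shiftBy (pegSize (A ⊕ B))) C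
    ≡⟨ Listₚ.++-assoc A _ _ ⟩
  A ++ (map (shiftBy (pegSize A)) B ++ map (shiftBy (pegSize (A ⊕ B))) C)
    ≡⟨ cong (λ Z → A ++ (map (shiftBy (pegSize A)) B ++ Z)) shift-twice ⟩
  A ++ (map (shiftBy (pegSize A)) B ++ map (shiftBy (pegSize A)) (map (shiftBy (pegSize B)) C))
    ≡⟨ cong (A ++_) (Listₚ.map-++ (shiftBy (pegSize A)) B _) ⟨
  A ⊕ (B ⊕ C) ∎
  where
  open ≡-Reasoning
  shift-+ : ∀ a c → c + p a (A ⊕ B) ≡ (c + p a B) + p a A
  shift-+ a c = trans (cong (c +_) (trans (p-⊕ a A B) (+-comm (p a A) (p a B)))) (sym (+-assoc c _ _))
  shift-twice : map (shiftBy (pegSize (A ⊕ B))) C ≡ map (shiftBy (pegSize A)) (map (shiftBy (pegSize B)) C)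
  shift-twice = trans (map-relabelEdge-cong _ (λ a c → (c + p a B) + p a A) shift-+ C) (Listₚ.map-∘ C)

⊕-↭ˡ : ∀ {X X'} Y → X ↭ X' → X ⊕ Y ↭ X' ⊕ Y
⊕-↭ˡ {X} {X'} Y X↭X' = ↭ₚ.++⁺ X↭X' (↭-reflexive
  (map-relabelEdge-cong (λ a c → c + p a X) (λ a c → c + p a X')
                        (λ a c → cong (c +_) (count-↭ (incident a) X↭X')) Y))

⨁ : List Diagram → Diagram
⨁ [] = []
⨁ (R ∷ Rs) = R ⊕ ⨁ Rs

foldl-⊕ : ∀ (G : ℕ → Diagram) A L → foldl (λ acc i → acc ⊕ G i) A L ≡ A ⊕ ⨁ (map G L)
foldl-⊕ G A [] = sym (Listₚ.++-identityʳ A)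
foldl-⊕ G A (x ∷ L) = trans (foldl-⊕ G (A ⊕ G x) L) (⊕-assoc A (G x) _)

⨁-∷ʳ : ∀ Rs R → ⨁ (Rs ∷ʳ R) ≡ ⨁ Rs ⊕ R
⨁-∷ʳ [] R = trans (Listₚ.++-identityʳ R) (sym (⊕-identityˡ R))
⨁-∷ʳ (R' ∷ Rs) R = trans (cong (R' ⊕_) (⨁-∷ʳ Rs R)) (sym (⊕-assoc R' (⨁ Rs) R))

p-⨁ : ∀ i Rs → p i (⨁ Rs) ≡ sum (map (p i) Rs)
p-⨁ i [] = refl
p-⨁ i (R ∷ Rs) = trans (p-⊕ i R (⨁ Rs)) (cong (p i R +_) (p-⨁ i Rs))

HeightsBoundedBy : (ℕ → ℕ) → Diagram → Set
HeightsBoundedBy P R = ∀ e → e ∈ R → ht₁ e ≤ P (src e) × ht₂ e ≤ P (tgt e)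

HeightsBounded : Diagram → Set
HeightsBounded R = HeightsBoundedBy (pegSize R) R

1+[q+r]∸[c+q]≡1+r∸c : ∀ q r c → suc (q + r) ∸ (c + q) ≡ suc r ∸ c
1+[q+r]∸[c+q]≡1+r∸c q r c = trans (cong₂ _∸_ (sym (+-suc q r)) (+-comm c q)) ([m+n]∸[m+o]≡n∸o q (suc r) c)

[1+q∸c]+r≡1+[q+r]∸c : ∀ q r c → c ≤ q → (suc q ∸ c) + r ≡ suc (q + r) ∸ c
[1+q∸c]+r≡1+[q+r]∸c q r c c≤q = sym (+-∸-comm r (m≤n⇒m≤1+n c≤q))

-- The bound on Q keeps the truncated subtractions exact.
flip-⊕ : ∀ Q R → HeightsBounded Q → flip R ⊕ flip Q ↭ flip (Q ⊕ R)
flip-⊕ Q R Q-bounded =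
  ↭-trans (↭ₚ.++-comm (flip R) _)
   (↭-reflexive (trans (cong₂ _++_ upper lower) (sym (Listₚ.map-++ (flipWith (pegSize (Q ⊕ R))) Q _))))
  where
  flipped-upper : ∀ a c → c ≤ p a Q → (suc (p a Q) ∸ c) + p a (flip R) ≡ suc (p a (Q ⊕ R)) ∸ c
  flipped-upper a c c≤ = begin
    (suc (p a Q) ∸ c) + p a (flip R) ≡⟨ cong ((suc (p a Q) ∸ c) +_) (p-relabel a _ R) ⟩
    (suc (p a Q) ∸ c) + p a R        ≡⟨ [1+q∸c]+r≡1+[q+r]∸c (p a Q) (p a R) c c≤ ⟩
    suc (p a Q + p a R) ∸ c          ≡⟨ cong (λ z → suc z ∸ c) (p-⊕ a Q R) ⟨
    suc (p a (Q ⊕ R)) ∸ c            ∎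
    where open ≡-Reasoning
  flipped-lower : ∀ a c → suc (p a R) ∸ c ≡ suc (p a (Q ⊕ R)) ∸ (c + p a Q)
  flipped-lower a c = trans (sym (1+[q+r]∸[c+q]≡1+r∸c (p a Q) (p a R) c))
                            (cong (λ z → suc z ∸ (c + p a Q)) (sym (p-⊕ a Q R)))
  upper : map (shiftBy (pegSize (flip R))) (flip Q) ≡ map (flipWith (pegSize (Q ⊕ R))) Q
  upper = trans (sym (Listₚ.map-∘ Q)) (Listₚ.map-cong-local (tabulate (λ {e} e∈ →
    relabelEdge-cong (λ a c → (suc (p a Q) ∸ c) + p a (flip R)) (λ a c → suc (p a (Q ⊕ R)) ∸ c) e
      (flipped-upper (src e) (ht₁ e) (proj₁ (Q-bounded e e∈)))
      (flipped-upper (tgt e) (ht₂ e) (proj₂ (Q-bounded e e∈))))))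
  lower : flip R ≡ map (flipWith (pegSize (Q ⊕ R))) (map (shiftBy (pegSize Q)) R)
  lower = trans (map-relabelEdge-cong (λ a c → suc (p a R) ∸ c) _ flipped-lower R) (Listₚ.map-∘ R)

⨁-reverse-flip : ∀ Rs → All HeightsBounded Rs → ⨁ (map flip (reverse Rs)) ↭ flip (⨁ Rs)
⨁-reverse-flip [] _ = ↭-refl
⨁-reverse-flip (R ∷ Rs) (R-bounded ∷ Rs-bounded) = begin
  ⨁ (map flip (reverse (R ∷ Rs)))         ≡⟨ cong (⨁ ∘ map flip) (Listₚ.unfold-reverse R Rs) ⟩
  ⨁ (map flip (reverse Rs ∷ʳ R))          ≡⟨ cong ⨁ (Listₚ.map-++ flip (reverse Rs) (R ∷ [])) ⟩
  ⨁ (map flip (reverse Rs) ∷ʳ flip R)     ≡⟨ ⨁-∷ʳ (map flip (reverse Rs)) (flip R) ⟩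
  ⨁ (map flip (reverse Rs)) ⊕ flip R      ↭⟨ ⊕-↭ˡ (flip R) (⨁-reverse-flip Rs Rs-bounded) ⟩
  flip (⨁ Rs) ⊕ flip R                    ↭⟨ flip-⊕ R (⨁ Rs) R-bounded ⟩
  flip (⨁ (R ∷ Rs))                       ∎
  where open PermutationReasoning

ht₁∈heightsOn : ∀ S e → e ∈ S → ht₁ e ∈ heightsOn (src e) S
ht₁∈heightsOn S e e∈ =
  ∈-++⁺ˡ (∈-map⁺ ht₁ (∈-filter⁺ (T? ∘ λ e' → src e' ≡ᵇ src e) e∈ (≡⇒≡ᵇ (src e) (src e) refl)))

ht₂∈heightsOn : ∀ S e → e ∈ S → ht₂ e ∈ heightsOn (tgt e) S
ht₂∈heightsOn S e e∈ = ∈-++⁺ʳ (map ht₁ (filterᵇ (λ e' → src e' ≡ᵇ tgt e) S))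
  (∈-map⁺ ht₂ (∈-filter⁺ (T? ∘ λ e' → tgt e' ≡ᵇ tgt e) e∈ (≡⇒≡ᵇ (tgt e) (tgt e) refl)))

∈heightsOn⁻ : ∀ a h S → h ∈ heightsOn a S →
  ∃ λ e → e ∈ S × ((src e ≡ a × ht₁ e ≡ h) ⊎ (tgt e ≡ a × ht₂ e ≡ h))
∈heightsOn⁻ a h S h∈ with ∈-++⁻ (map ht₁ (filterᵇ (λ e → src e ≡ᵇ a) S)) h∈
... | inj₁ h∈₁ with ∈-map⁻ ht₁ h∈₁
...   | e , e∈ , h≡ with ∈-filter⁻ (T? ∘ λ e → src e ≡ᵇ a) e∈
...     | e∈S , src≡ = e , e∈S , inj₁ (≡ᵇ⇒≡ _ a src≡ , sym h≡)
∈heightsOn⁻ a h S h∈ | inj₂ h∈₂ with ∈-map⁻ ht₂ h∈₂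
...   | e , e∈ , h≡ with ∈-filter⁻ (T? ∘ λ e → tgt e ≡ᵇ a) e∈
...     | e∈S , tgt≡ = e , e∈S , inj₂ (≡ᵇ⇒≡ _ a tgt≡ , sym h≡)

heightsOn-⊆ : ∀ a {C D} → C ⊆ D → heightsOn a C ⊆ heightsOn a D
heightsOn-⊆ a C⊆D = ⊆ₚ.++⁺ (⊆ₚ.map⁺ ht₁ (⊆ₚ.filter⁺ _ _ (λ { refl t → t }) C⊆D))
                           (⊆ₚ.map⁺ ht₂ (⊆ₚ.filter⁺ _ _ (λ { refl t → t }) C⊆D))

Loopless : Diagram → Set
Loopless S = ∀ e → e ∈ S → src e ≢ tgt e

Loopless-⊆ : ∀ {C D} → C ⊆ D → Loopless D → Loopless C
Loopless-⊆ C⊆D loopless e = loopless e ∘ ⊆ₚ.Any-resp-⊆ C⊆D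

length-heightsOn : ∀ a S → Loopless S → length (heightsOn a S) ≡ p a S
length-heightsOn a S loopless = begin
  length (heightsOn a S)                                    ≡⟨ Listₚ.length-++ (map ht₁ (filterᵇ out S)) ⟩
  length (map ht₁ (filterᵇ out S)) + length (map ht₂ (filterᵇ in' S))
    ≡⟨ cong₂ _+_ (Listₚ.length-map ht₁ (filterᵇ out S)) (Listₚ.length-map ht₂ (filterᵇ in' S)) ⟩
  count out S + count in' S                                 ≡⟨ count-∨ out in' S endpoints-differ ⟩
  p a S                                                     ∎
  where
  open ≡-Reasoning
  out in' : Edge → Bool
  out e = src e ≡ᵇ a
  in' e = tgt e ≡ᵇ a
  endpoints-differ : ∀ e → e ∈ S → out e ≡ true → in' e ≡ true → ⊥
  endpoints-differ e e∈ src≡ tgt≡ = loopless e e∈ (trans (≡ᵇ-true⇒≡ _ a src≡) (sym (≡ᵇ-true⇒≡ _ a tgt≡)))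

heightsOn-flip : ∀ P a C → heightsOn a (map (flipWith P) C) ≡ map (λ h → suc (P a) ∸ h) (heightsOn a C)
heightsOn-flip P a C =
  trans (cong₂ _++_ (outgoing C) (incoming C))
        (sym (Listₚ.map-++ (λ h → suc (P a) ∸ h) (map ht₁ (filterᵇ (λ e → src e ≡ᵇ a) C)) _))
  where
  outgoing : ∀ C → map ht₁ (filterᵇ (λ e → src e ≡ᵇ a) (map (flipWith P) C))
                 ≡ map (λ h → suc (P a) ∸ h) (map ht₁ (filterᵇ (λ e → src e ≡ᵇ a) C))
  outgoing [] = refl
  outgoing ((x , y , c , d) ∷ C) with x ≡ᵇ a in x≡a
  ... | true = cong₂ _∷_ (cong (λ z → suc (P z) ∸ c) (≡ᵇ-true⇒≡ x a x≡a)) (outgoing C)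
  ... | false = outgoing C
  incoming : ∀ C → map ht₂ (filterᵇ (λ e → tgt e ≡ᵇ a) (map (flipWith P) C))
                 ≡ map (λ h → suc (P a) ∸ h) (map ht₂ (filterᵇ (λ e → tgt e ≡ᵇ a) C))
  incoming [] = refl
  incoming ((x , y , c , d) ∷ C) with y ≡ᵇ a in y≡a
  ... | true = cong₂ _∷_ (cong (λ z → suc (P z) ∸ d) (≡ᵇ-true⇒≡ y a y≡a)) (incoming C)
  ... | false = incoming C

count-partition₃ : {A : Set} (P Q R : A → Bool) → ∀ xs → (∀ x → x ∈ xs → 𝟙 (P x) + (𝟙 (Q x) + 𝟙 (R x)) ≡ 1) →
  count P xs + (count Q xs + count R xs) ≡ length xs
count-partition₃ P Q R [] _ = refl
count-partition₃ P Q R (x ∷ xs) exactly-one = begin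
  count P (x ∷ xs) + (count Q (x ∷ xs) + count R (x ∷ xs))
    ≡⟨ cong₂ _+_ (count-∷ P x xs) (cong₂ _+_ (count-∷ Q x xs) (count-∷ R x xs)) ⟩
  (𝟙 (P x) + count P xs) + ((𝟙 (Q x) + count Q xs) + (𝟙 (R x) + count R xs))
    ≡⟨ interchange (𝟙 (P x)) (count P xs) (𝟙 (Q x)) (count Q xs) (𝟙 (R x)) (count R xs) ⟩
  (𝟙 (P x) + (𝟙 (Q x) + 𝟙 (R x))) + (count P xs + (count Q xs + count R xs))
    ≡⟨ cong₂ _+_ (exactly-one x (here refl)) (count-partition₃ P Q R xs (λ y → exactly-one y ∘ there)) ⟩
  suc (length xs) ∎
  where
  open ≡-Reasoning
  interchange : ∀ a A b B c C → (a + A) + ((b + B) + (c + C)) ≡ (a + (b + c)) + (A + (B + C))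
  interchange = solve 6 (λ a A b B c C → (a :+ A) :+ ((b :+ B) :+ (c :+ C))
                                       := (a :+ (b :+ c)) :+ (A :+ (B :+ C))) refl
    where open +-*-Solver

-- Flipping reverses the order of heights in [1, P]: after the flip h lies below c exactly when h lay above c.
flip-trichotomy : ∀ P h c → h ≤ P → c ≤ P → 𝟙 ((suc P ∸ h) <ᵇ (suc P ∸ c)) + (𝟙 (h <ᵇ c) + 𝟙 (h ≡ᵇ c)) ≡ 1
flip-trichotomy P h c h≤P c≤P with <-cmp h c
... | tri< h<c _ _ rewrite ≢⇒≡ᵇ-false h c (<⇒≢ h<c) | <⇒<ᵇ-true h<c
                          | ≥⇒<ᵇ-false (suc P ∸ h) (suc P ∸ c) (∸-monoʳ-≤ (suc P) (<⇒≤ h<c)) = refl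
... | tri≈ _ refl _ rewrite ≡ᵇ-refl h | ≥⇒<ᵇ-false h h ≤-refl | ≥⇒<ᵇ-false (suc P ∸ h) (suc P ∸ h) ≤-refl = refl
... | tri> _ _ c<h rewrite ≢⇒≡ᵇ-false h c (λ h≡c → <⇒≢ c<h (sym h≡c)) | ≥⇒<ᵇ-false h c (<⇒≤ c<h)
                          | <⇒<ᵇ-true (∸-monoʳ-< c<h (m≤n⇒m≤1+n h≤P)) = refl

m+[n+1]∸n≡1+m : ∀ m n → (m + (n + 1)) ∸ n ≡ suc m
m+[n+1]∸n≡1+m m n =
  trans (cong (_∸ n) (trans (cong (m +_) (+-comm n 1)) (trans (+-suc m n) (+-comm (suc m) n))))
        (m+n∸m≡n n (suc m))

record WellLabelled (D : Diagram) : Set where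
  field
    loopless : Loopless D
    height-range : ∀ a h → h ∈ heightsOn a D → 1 ≤ h × h ≤ p a D
    height-unique : ∀ a h → h ∈ heightsOn a D → count (_≡ᵇ h) (heightsOn a D) ≤ 1

rank-flip : ∀ {D C} → WellLabelled D → C ⊆ D → ∀ a c → c ∈ heightsOn a C →
  rank a (suc (p a D) ∸ c) (map (flipWith (pegSize D)) C) ≡ suc (p a (rel C)) ∸ rank a c C
rank-flip {D} {C} wl C⊆D a c c∈ = begin
  rank a (suc Pa ∸ c) (map (flipWith (pegSize D)) C)
    ≡⟨ cong (suc ∘ count (_<ᵇ (suc Pa ∸ c))) (heightsOn-flip (pegSize D) a C) ⟩
  suc (count (_<ᵇ (suc Pa ∸ c)) (map (suc Pa ∸_) H))    ≡⟨ cong suc (count-map _ (suc Pa ∸_) H) ⟩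
  suc (count above H)                                    ≡⟨ m+[n+1]∸n≡1+m (count above H) (count below H) ⟨
  (count above H + (count below H + 1)) ∸ count below H
    ≡⟨ cong (λ z → (count above H + (count below H + z)) ∸ count below H) c-once ⟨
  (count above H + (count below H + count (_≡ᵇ c) H)) ∸ count below H
    ≡⟨ cong (_∸ count below H) (count-partition₃ above below (_≡ᵇ c) H
          (λ h h∈ → flip-trichotomy Pa h c (≤Pa h h∈) (≤Pa c c∈))) ⟩
  length H ∸ count below H
    ≡⟨ cong (_∸ count below H) (length-heightsOn a C (Loopless-⊆ C⊆D loopless)) ⟩
  p a C ∸ count below H                                  ≡⟨ cong (_∸ count below H) (p-relabel a _ C) ⟨
  suc (p a (rel C)) ∸ rank a c C                         ∎
  where
  open ≡-Reasoning
  open WellLabelled wl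
  Pa : ℕ
  Pa = p a D
  H : List ℕ
  H = heightsOn a C
  above below : ℕ → Bool
  above h = (suc Pa ∸ h) <ᵇ (suc Pa ∸ c)
  below h = h <ᵇ c
  H⊆ : H ⊆ heightsOn a D
  H⊆ = heightsOn-⊆ a C⊆D
  ≤Pa : ∀ h → h ∈ H → h ≤ Pa
  ≤Pa h h∈ = proj₂ (height-range a h (⊆ₚ.Any-resp-⊆ H⊆ h∈))
  c-once : count (_≡ᵇ c) H ≡ 1
  c-once = ≤-antisym (≤-trans (count-mono-⊆ (_≡ᵇ c) H⊆) (height-unique a c (⊆ₚ.Any-resp-⊆ H⊆ c∈)))
                     (count-pos (_≡ᵇ c) c∈ (≡ᵇ-refl c))

rel-flip : ∀ {D C} → WellLabelled D → C ⊆ D → rel (map (flipWith (pegSize D)) C) ≡ flip (rel C)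
rel-flip {D} {C} wl C⊆D =
  trans (sym (Listₚ.map-∘ C))
   (trans (Listₚ.map-cong-local (tabulate (λ {e} e∈ → relabelEdge-cong
             (λ a c → rank a (suc (p a D) ∸ c) (map (flipWith (pegSize D)) C))
             (λ a c → suc (p a (rel C)) ∸ rank a c C) e
             (rank-flip wl C⊆D (src e) (ht₁ e) (ht₁∈heightsOn C e e∈))
             (rank-flip wl C⊆D (tgt e) (ht₂ e) (ht₂∈heightsOn C e e∈)))))
     (Listₚ.map-∘ C))

rank≤p-rel : ∀ C a c → Loopless C → c ∈ heightsOn a C → rank a c C ≤ p a (rel C)
rank≤p-rel C a c loopless c∈ = ≤-trans (count<length (_<ᵇ c) c∈ (≥⇒<ᵇ-false c c ≤-refl))
  (≤-reflexive (trans (length-heightsOn a C loopless) (sym (p-relabel a _ C))))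

rel-bounded : ∀ C → Loopless C → HeightsBounded (rel C)
rel-bounded C loopless _ e∈ with ∈-map⁻ (relabelEdge (λ a c → rank a c C)) e∈
... | e , e∈C , refl = rank≤p-rel C (src e) (ht₁ e) loopless (ht₁∈heightsOn C e e∈C) ,
                       rank≤p-rel C (tgt e) (ht₂ e) loopless (ht₂∈heightsOn C e e∈C)

oneTo : ℕ → List ℕ
oneTo ℓ = map suc (upTo ℓ)

InOneTo : ℕ → ℕ → Set
InOneTo ℓ c = 1 ≤ c × c ≤ ℓ

reverseColour : ℕ → ℕ → ℕ
reverseColour ℓ c = suc ℓ ∸ c

reverseColour-involutive : ∀ ℓ c → c ≤ ℓ → reverseColour ℓ (reverseColour ℓ c) ≡ c
reverseColour-involutive ℓ c c≤ℓ = m∸[m∸n]≡n (m≤n⇒m≤1+n c≤ℓ)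

reverseColour-≡ᵇ : ∀ ℓ c i → InOneTo ℓ c → InOneTo ℓ i → (reverseColour ℓ c ≡ᵇ i) ≡ (c ≡ᵇ reverseColour ℓ i)
reverseColour-≡ᵇ ℓ c i (_ , c≤ℓ) (_ , i≤ℓ) = T⇔T⇒≡
  (λ t → ≡⇒≡ᵇ c (reverseColour ℓ i)
           (trans (sym (reverseColour-involutive ℓ c c≤ℓ)) (cong (reverseColour ℓ) (≡ᵇ⇒≡ (reverseColour ℓ c) i t))))
  (λ t → ≡⇒≡ᵇ (reverseColour ℓ c) i
           (trans (cong (reverseColour ℓ) (≡ᵇ⇒≡ c (reverseColour ℓ i) t)) (reverseColour-involutive ℓ i i≤ℓ)))

oneTo-∷ʳ : ∀ ℓ → oneTo (suc ℓ) ≡ oneTo ℓ ∷ʳ suc ℓ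
oneTo-∷ʳ ℓ = trans (cong (map suc) (sym (Listₚ.upTo-∷ʳ ℓ))) (Listₚ.map-++ suc (upTo ℓ) (ℓ ∷ []))

oneTo-∷ : ∀ ℓ → oneTo (suc ℓ) ≡ 1 ∷ map suc (oneTo ℓ)
oneTo-∷ ℓ = cong (λ z → 1 ∷ map suc z) (sym (Listₚ.map-upTo suc ℓ))

∈oneTo⇒InOneTo : ∀ ℓ c → c ∈ oneTo ℓ → InOneTo ℓ c
∈oneTo⇒InOneTo (suc ℓ) c c∈ with ∈-++⁻ (oneTo ℓ) (subst (c ∈_) (oneTo-∷ʳ ℓ) c∈)
... | inj₁ c∈' = map₂ m≤n⇒m≤1+n (∈oneTo⇒InOneTo ℓ c c∈')
... | inj₂ (here refl) = s≤s z≤n , ≤-refl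

InOneTo⇒∈oneTo : ∀ ℓ c → InOneTo ℓ c → c ∈ oneTo ℓ
InOneTo⇒∈oneTo zero c (1≤c , c≤0) = ⊥-elim (<⇒≱ 1≤c c≤0)
InOneTo⇒∈oneTo (suc ℓ) c (1≤c , c≤1+ℓ) =
  subst (c ∈_) (sym (oneTo-∷ʳ ℓ)) (last-or-earlier (m≤n⇒m<n∨m≡n c≤1+ℓ))
  where
  last-or-earlier : c < suc ℓ ⊎ c ≡ suc ℓ → c ∈ oneTo ℓ ∷ʳ suc ℓ
  last-or-earlier (inj₁ (s≤s c≤ℓ)) = ∈-++⁺ˡ (InOneTo⇒∈oneTo ℓ c (1≤c , c≤ℓ))
  last-or-earlier (inj₂ refl) = ∈-++⁺ʳ (oneTo ℓ) (here refl)

count-oneTo : ∀ ℓ c → InOneTo ℓ c → count (c ≡ᵇ_) (oneTo ℓ) ≡ 1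
count-oneTo zero c (1≤c , c≤0) = ⊥-elim (<⇒≱ 1≤c c≤0)
count-oneTo (suc ℓ) c (1≤c , c≤1+ℓ) =
  trans (cong (count (c ≡ᵇ_)) (oneTo-∷ʳ ℓ))
        (trans (count-++ (c ≡ᵇ_) (oneTo ℓ) _) (last-or-earlier (m≤n⇒m<n∨m≡n c≤1+ℓ)))
  where
  last-or-earlier : c < suc ℓ ⊎ c ≡ suc ℓ → count (c ≡ᵇ_) (oneTo ℓ) + count (c ≡ᵇ_) (suc ℓ ∷ []) ≡ 1
  last-or-earlier (inj₁ (s≤s c≤ℓ))
    rewrite count-oneTo ℓ c (1≤c , c≤ℓ) | ≢⇒≡ᵇ-false c (suc ℓ) (<⇒≢ (s≤s c≤ℓ)) = refl
  last-or-earlier (inj₂ refl) rewrite ≡ᵇ-refl ℓ =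
    cong (_+ 1) (count-none _ (oneTo ℓ) (λ x x∈ → ≢⇒≡ᵇ-false (suc ℓ) x (λ 1+ℓ≡x →
      <⇒≱ (s≤s ≤-refl) (subst (_≤ ℓ) (sym 1+ℓ≡x) (proj₂ (∈oneTo⇒InOneTo ℓ x x∈))))))

map-reverseColour-oneTo : ∀ ℓ → map (reverseColour ℓ) (oneTo ℓ) ≡ reverse (oneTo ℓ)
map-reverseColour-oneTo zero = refl
map-reverseColour-oneTo (suc ℓ) = begin
  map (reverseColour (suc ℓ)) (oneTo (suc ℓ))             ≡⟨ cong (map (reverseColour (suc ℓ))) (oneTo-∷ ℓ) ⟩
  suc ℓ ∷ map (reverseColour (suc ℓ)) (map suc (oneTo ℓ)) ≡⟨ cong (suc ℓ ∷_) (Listₚ.map-∘ (oneTo ℓ)) ⟨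
  suc ℓ ∷ map (reverseColour ℓ) (oneTo ℓ)                 ≡⟨ cong (suc ℓ ∷_) (map-reverseColour-oneTo ℓ) ⟩
  suc ℓ ∷ reverse (oneTo ℓ)                               ≡⟨ Listₚ.reverse-++ (oneTo ℓ) (suc ℓ ∷ []) ⟨
  reverse (oneTo ℓ ∷ʳ suc ℓ)                              ≡⟨ cong reverse (oneTo-∷ʳ ℓ) ⟨
  reverse (oneTo (suc ℓ))                                 ∎
  where open ≡-Reasoning

colourClass-∷ : ∀ e D c α i →
  colourClass (e ∷ D) (c ∷ α) i ≡ (if c ≡ᵇ i then e ∷ colourClass D α i else colourClass D α i)
colourClass-∷ e D c α i with c ≡ᵇ i
... | true = refl
... | false = refl

colourClass-⊆ : ∀ D α i → colourClass D α i ⊆ D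
colourClass-⊆ [] α i = Sublist.[]
colourClass-⊆ (e ∷ D) [] i = ⊆ₚ.[]⊆-universal (e ∷ D)
colourClass-⊆ (e ∷ D) (c ∷ α) i rewrite colourClass-∷ e D c α i with c ≡ᵇ i
... | true = refl Sublist.∷ colourClass-⊆ D α i
... | false = e Sublist.∷ʳ colourClass-⊆ D α i

colourClass-reverse : ∀ ℓ (φ : Edge → Edge) D α i → All (InOneTo ℓ) α → InOneTo ℓ i →
  colourClass (map φ D) (map (reverseColour ℓ) α) i ≡ map φ (colourClass D α (reverseColour ℓ i))
colourClass-reverse ℓ φ [] α i _ _ = refl
colourClass-reverse ℓ φ (e ∷ D) [] i _ _ = refl
colourClass-reverse ℓ φ (e ∷ D) (c ∷ α) i (c-in ∷ α-in) i-in
  rewrite colourClass-∷ (φ e) (map φ D) (reverseColour ℓ c) (map (reverseColour ℓ) α) i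
        | colourClass-∷ e D c α (reverseColour ℓ i) | reverseColour-≡ᵇ ℓ c i c-in i-in
  with c ≡ᵇ reverseColour ℓ i
... | true = cong (φ e ∷_) (colourClass-reverse ℓ φ D α i α-in i-in)
... | false = colourClass-reverse ℓ φ D α i α-in i-in

sum-map-𝟙-unique : ∀ L c b → count (c ≡ᵇ_) L ≡ 1 → sum (map (λ i → 𝟙 ((c ≡ᵇ i) ∧ b)) L) ≡ 𝟙 b
sum-map-𝟙-unique L c true c-once =
  trans (sum-map-𝟙 L (λ i → (c ≡ᵇ i) ∧ true))
        (trans (count-cong _ _ L (λ i _ → Boolₚ.∧-identityʳ (c ≡ᵇ i))) c-once)
sum-map-𝟙-unique L c false _ =
  trans (sum-map-𝟙 L (λ i → (c ≡ᵇ i) ∧ false)) (count-none _ L (λ i _ → Boolₚ.∧-zeroʳ (c ≡ᵇ i)))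

count-colourClass-∷ : ∀ Q e D c α i →
  count Q (colourClass (e ∷ D) (c ∷ α) i) ≡ 𝟙 ((c ≡ᵇ i) ∧ Q e) + count Q (colourClass D α i)
count-colourClass-∷ Q e D c α i rewrite colourClass-∷ e D c α i with c ≡ᵇ i
... | true = count-∷ Q e (colourClass D α i)
... | false = refl

sum-count-colourClass : ∀ Q L D α → length α ≡ length D → All (λ c → count (c ≡ᵇ_) L ≡ 1) α →
  sum (map (λ i → count Q (colourClass D α i)) L) ≡ count Q D
sum-count-colourClass Q L [] [] _ _ = sum-map-0 L
sum-count-colourClass Q L (e ∷ D) (c ∷ α) |α|≡|D| (c-once ∷ α-once) = begin
  sum (map (λ i → count Q (colourClass (e ∷ D) (c ∷ α) i)) L)
    ≡⟨ cong sum (Listₚ.map-cong (count-colourClass-∷ Q e D c α) L) ⟩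
  sum (map (λ i → 𝟙 ((c ≡ᵇ i) ∧ Q e) + count Q (colourClass D α i)) L)
    ≡⟨ sum-map-+ L (λ i → 𝟙 ((c ≡ᵇ i) ∧ Q e)) (λ i → count Q (colourClass D α i)) ⟩
  sum (map (λ i → 𝟙 ((c ≡ᵇ i) ∧ Q e)) L) + sum (map (λ i → count Q (colourClass D α i)) L)
    ≡⟨ cong₂ _+_ (sum-map-𝟙-unique L c (Q e) c-once)
                 (sum-count-colourClass Q L D α (suc-injective |α|≡|D|) α-once) ⟩
  𝟙 (Q e) + count Q D
    ≡⟨ count-∷ Q e D ⟨
  count Q (e ∷ D) ∎
  where open ≡-Reasoning

-- Heights on the pegs of a web diagram are distinct

length≤sum : ∀ xs → (∀ x → x ∈ xs → 1 ≤ x) → length xs ≤ sum xs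
length≤sum [] _ = z≤n
length≤sum (x ∷ xs) pos = +-mono-≤ (pos x (here refl)) (length≤sum xs (λ y → pos y ∘ there))

sum≡length⇒≤1 : ∀ xs → (∀ x → x ∈ xs → 1 ≤ x) → sum xs ≡ length xs → ∀ x → x ∈ xs → x ≤ 1
sum≡length⇒≤1 (y ∷ ys) pos sum≡length x x∈ = at x∈
  where
  ys-pos : ∀ x → x ∈ ys → 1 ≤ x
  ys-pos z = pos z ∘ there
  |ys|≤Σys : length ys ≤ sum ys
  |ys|≤Σys = length≤sum ys ys-pos
  y≤1 : y ≤ 1
  y≤1 = +-cancelʳ-≤ (sum ys) y 1 (≤-trans (≤-reflexive sum≡length) (s≤s |ys|≤Σys))
  Σys≡|ys| : sum ys ≡ length ys
  Σys≡|ys| = ≤-antisym (+-cancelˡ-≤ 1 (sum ys) (length ys)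
    (≤-trans (+-monoˡ-≤ (sum ys) (pos y (here refl))) (≤-reflexive sum≡length))) |ys|≤Σys
  at : x ∈ y ∷ ys → x ≤ 1
  at (here refl) = y≤1
  at (there x∈ys) = sum≡length⇒≤1 ys ys-pos Σys≡|ys| x x∈ys

sum-multiplicities : ∀ N H → (∀ h → h ∈ H → InOneTo N h) →
  sum (map (λ k → count (_≡ᵇ k) H) (oneTo N)) ≡ length H
sum-multiplicities N [] _ = sum-map-0 (oneTo N)
sum-multiplicities N (x ∷ H) H-in = begin
  sum (map (λ k → count (_≡ᵇ k) (x ∷ H)) (oneTo N))
    ≡⟨ cong sum (Listₚ.map-cong (λ k → count-∷ (_≡ᵇ k) x H) (oneTo N)) ⟩
  sum (map (λ k → 𝟙 (x ≡ᵇ k) + count (_≡ᵇ k) H) (oneTo N))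
    ≡⟨ sum-map-+ (oneTo N) (λ k → 𝟙 (x ≡ᵇ k)) (λ k → count (_≡ᵇ k) H) ⟩
  sum (map (𝟙 ∘ (x ≡ᵇ_)) (oneTo N)) + sum (map (λ k → count (_≡ᵇ k) H) (oneTo N))
    ≡⟨ cong₂ _+_ (trans (sum-map-𝟙 (oneTo N) (x ≡ᵇ_)) (count-oneTo N x (H-in x (here refl))))
                 (sum-multiplicities N H (λ h → H-in h ∘ there)) ⟩
  suc (length H) ∎
  where open ≡-Reasoning

pigeonhole : ∀ N H → length H ≡ N → (∀ h → h ∈ H → InOneTo N h) → (∀ k → InOneTo N k → k ∈ H) →
  ∀ c → InOneTo N c → count (_≡ᵇ c) H ≤ 1
pigeonhole N H |H|≡N H-in covers c c-in =
  sum≡length⇒≤1 (map multiplicity (oneTo N)) multiplicity-pos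
    (trans (sum-multiplicities N H H-in) (trans |H|≡N (sym |oneTo|≡N)))
    (multiplicity c) (∈-map⁺ multiplicity (InOneTo⇒∈oneTo N c c-in))
  where
  multiplicity : ℕ → ℕ
  multiplicity k = count (_≡ᵇ k) H
  multiplicity-pos : ∀ m → m ∈ map multiplicity (oneTo N) → 1 ≤ m
  multiplicity-pos m m∈ with ∈-map⁻ multiplicity m∈
  ... | k , k∈ , refl = count-pos (_≡ᵇ k) (covers k (∈oneTo⇒InOneTo N k k∈)) (≡ᵇ-refl k)
  |oneTo|≡N : length (map multiplicity (oneTo N)) ≡ N
  |oneTo|≡N = trans (Listₚ.length-map multiplicity (oneTo N))
                  (trans (Listₚ.length-map suc (upTo N)) (Listₚ.length-upTo N))

webDiagram⇒wellLabelled : ∀ {n D} → IsWebDiagram n D → WellLabelled D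
webDiagram⇒wellLabelled {n} {D} (edge-ranges , peg-heights) = record
  { loopless = loopless
  ; height-range = height-range
  ; height-unique = λ a h h∈ → let (1≤a , a≤n) = peg-range a h h∈ in
      pigeonhole (p a D) (heightsOn a D) (length-heightsOn a D loopless)
        (height-range a) (covers a 1≤a a≤n) h (height-range a h h∈)
  }
  where
  loopless : Loopless D
  loopless e e∈ = <⇒≢ (proj₁ (proj₂ (edge-ranges e e∈)))
  peg-range : ∀ a h → h ∈ heightsOn a D → 1 ≤ a × a ≤ n
  peg-range a h h∈ with ∈heightsOn⁻ a h D h∈
  ... | e , e∈ , inj₁ (refl , _) = let (1≤src , src<tgt , tgt≤n , _) = edge-ranges e e∈
                                   in 1≤src , ≤-trans (<⇒≤ src<tgt) tgt≤n
  ... | e , e∈ , inj₂ (refl , _) = let (1≤src , src<tgt , tgt≤n , _) = edge-ranges e e∈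
                                   in ≤-trans 1≤src (<⇒≤ src<tgt) , tgt≤n
  height-range : ∀ a h → h ∈ heightsOn a D → 1 ≤ h × h ≤ p a D
  height-range a h h∈ with peg-range a h h∈ | ∈heightsOn⁻ a h D h∈
  ... | 1≤a , a≤n | e , e∈ , inj₁ src-ht = proj₁ (peg-heights a 1≤a a≤n h) (inj₁ (lose e∈ src-ht))
  ... | 1≤a , a≤n | e , e∈ , inj₂ tgt-ht = proj₁ (peg-heights a 1≤a a≤n h) (inj₂ (lose e∈ tgt-ht))
  covers : ∀ a → 1 ≤ a → a ≤ n → ∀ k → InOneTo (p a D) k → k ∈ heightsOn a D
  covers a 1≤a a≤n k k-in with proj₁ (proj₂ (peg-heights a 1≤a a≤n k)) k-in
  ... | inj₁ at-src with find at-src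
  ...   | e , e∈ , refl , refl = ht₁∈heightsOn D e e∈
  covers a 1≤a a≤n k k-in | inj₂ at-tgt with find at-tgt
  ...   | e , e∈ , refl , refl = ht₂∈heightsOn D e e∈

-- Reconstruction commutes with flipping

reconstruct-⨁ : ∀ ℓ D α → reconstruct ℓ D α ≡ ⨁ (map (λ i → rel (colourClass D α i)) (oneTo ℓ))
reconstruct-⨁ ℓ D α = trans (foldl-⊕ (λ i → rel (colourClass D α i)) [] (oneTo ℓ)) (⊕-identityˡ _)

p-reconstruct : ∀ ℓ D α → length α ≡ length D → All (InOneTo ℓ) α → ∀ a → p a (reconstruct ℓ D α) ≡ p a D
p-reconstruct ℓ D α |α|≡|D| α-in a = begin
  p a (reconstruct ℓ D α)                            ≡⟨ cong (p a) (reconstruct-⨁ ℓ D α) ⟩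
  p a (⨁ (map class (oneTo ℓ)))                      ≡⟨ p-⨁ a (map class (oneTo ℓ)) ⟩
  sum (map (p a) (map class (oneTo ℓ)))              ≡⟨ cong sum (Listₚ.map-∘ (oneTo ℓ)) ⟨
  sum (map (p a ∘ class) (oneTo ℓ))
    ≡⟨ cong sum (Listₚ.map-cong (λ i → p-relabel a _ (colourClass D α i)) (oneTo ℓ)) ⟩
  sum (map (λ i → p a (colourClass D α i)) (oneTo ℓ))
    ≡⟨ sum-count-colourClass (incident a) (oneTo ℓ) D α |α|≡|D| (All.map (count-oneTo ℓ _) α-in) ⟩
  p a D                                              ∎
  where
  open ≡-Reasoning
  class : ℕ → Diagram
  class i = rel (colourClass D α i)

reconstruct-flip : ∀ {ℓ D α} → WellLabelled D → length α ≡ length D → All (InOneTo ℓ) α →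
  reconstruct ℓ (flip D) (map (reverseColour ℓ) α) ↭ map (flipWith (pegSize D)) (reconstruct ℓ D α)
reconstruct-flip {ℓ} {D} {α} wl |α|≡|D| α-in = begin
  reconstruct ℓ (flip D) (map (reverseColour ℓ) α)
    ≡⟨ reconstruct-⨁ ℓ (flip D) _ ⟩
  ⨁ (map (λ i → rel (colourClass (flip D) (map (reverseColour ℓ) α) i)) (oneTo ℓ))
    ≡⟨ cong ⨁ (Listₚ.map-cong-local (tabulate (λ {i} → class-flip i ∘ ∈oneTo⇒InOneTo ℓ i))) ⟩
  ⨁ (map (flip ∘ class ∘ reverseColour ℓ) (oneTo ℓ))
    ≡⟨ cong ⨁ classes-reversed ⟩
  ⨁ (map flip (reverse (map class (oneTo ℓ))))
    ↭⟨ ⨁-reverse-flip (map class (oneTo ℓ)) (All-map⁺ (universal class-bounded (oneTo ℓ))) ⟩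
  flip (⨁ (map class (oneTo ℓ)))
    ≡⟨ cong flip (reconstruct-⨁ ℓ D α) ⟨
  flip (reconstruct ℓ D α)
    ≡⟨ flip-pegSize (reconstruct ℓ D α) (p-reconstruct ℓ D α |α|≡|D| α-in) ⟩
  map (flipWith (pegSize D)) (reconstruct ℓ D α) ∎
  where
  open PermutationReasoning
  open WellLabelled wl using (loopless)
  class : ℕ → Diagram
  class i = rel (colourClass D α i)
  class-flip : ∀ i → InOneTo ℓ i →
    rel (colourClass (flip D) (map (reverseColour ℓ) α) i) ≡ flip (class (reverseColour ℓ i))
  class-flip i i-in = trans (cong rel (colourClass-reverse ℓ (flipWith (pegSize D)) D α i α-in i-in))
                            (rel-flip wl (colourClass-⊆ D α (reverseColour ℓ i)))
  class-bounded : ∀ i → HeightsBounded (class i)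
  class-bounded i = rel-bounded (colourClass D α i) (Loopless-⊆ (colourClass-⊆ D α i) loopless)
  classes-reversed : map (flip ∘ class ∘ reverseColour ℓ) (oneTo ℓ) ≡ map flip (reverse (map class (oneTo ℓ)))
  classes-reversed = trans (Listₚ.map-∘ (oneTo ℓ)) (cong (map flip)
    (trans (Listₚ.map-∘ (oneTo ℓ))
      (trans (cong (map class) (map-reverseColour-oneTo ℓ)) (Listₚ.reverse-map class (oneTo ℓ)))))

-- Set equality of diagrams, and injectivity of flipping

≡ᴱ⇒≡ : ∀ e e' → T (e ≡ᴱ e') → e ≡ e'
≡ᴱ⇒≡ (a , b , c , d) (a' , b' , c' , d') t
  with ta , t' ← Equivalence.to Boolₚ.T-∧ t
  with tb , t'' ← Equivalence.to Boolₚ.T-∧ t'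
  with tc , td ← Equivalence.to Boolₚ.T-∧ t''
  = cong₂ _,_ (≡ᵇ⇒≡ a a' ta) (cong₂ _,_ (≡ᵇ⇒≡ b b' tb) (cong₂ _,_ (≡ᵇ⇒≡ c c' tc) (≡ᵇ⇒≡ d d' td)))

≡ᴱ-refl : ∀ e → T (e ≡ᴱ e)
≡ᴱ-refl (a , b , c , d) = Equivalence.from Boolₚ.T-∧ (≡⇒≡ᵇ a a refl ,
  Equivalence.from Boolₚ.T-∧ (≡⇒≡ᵇ b b refl , Equivalence.from Boolₚ.T-∧ (≡⇒≡ᵇ c c refl , ≡⇒≡ᵇ d d refl)))

all-any-≡ᴱ⇒⊆ : ∀ X Y → T (all (λ e → any (e ≡ᴱ_) Y) X) → ∀ {e} → e ∈ X → e ∈ Y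
all-any-≡ᴱ⇒⊆ X Y t e∈ = Any.map (≡ᴱ⇒≡ _ _) (any⁻ _ Y (All.lookup (all⁺ _ X t) e∈))

⊆⇒all-any-≡ᴱ : ∀ X Y → (∀ {e} → e ∈ X → e ∈ Y) → T (all (λ e → any (e ≡ᴱ_) Y) X)
⊆⇒all-any-≡ᴱ X Y X⊆Y = all⁻ _ (tabulate (λ {e} e∈ → any⁺ _ (Any.map (λ { refl → ≡ᴱ-refl e }) (X⊆Y e∈))))

sameSet-sound : ∀ X Y → T (sameSet X Y) → X ∼[ set ] Y
sameSet-sound X Y t with tXY , tYX ← Equivalence.to Boolₚ.T-∧ t =
  mk⇔ (all-any-≡ᴱ⇒⊆ X Y tXY) (all-any-≡ᴱ⇒⊆ Y X tYX)

sameSet-complete : ∀ X Y → X ∼[ set ] Y → T (sameSet X Y)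
sameSet-complete X Y X∼Y = Equivalence.from Boolₚ.T-∧
  (⊆⇒all-any-≡ᴱ X Y (Equivalence.to X∼Y) , ⊆⇒all-any-≡ᴱ Y X (Equivalence.from X∼Y))

1+n∸-injective : ∀ n c c' → c' ≤ n → suc n ∸ c ≡ suc n ∸ c' → c ≡ c'
1+n∸-injective n c c' c'≤n eq = ∸-cancelˡ-≡ (<⇒≤ c<1+n) (m≤n⇒m≤1+n c'≤n) eq
  where
  c<1+n : c < suc n
  c<1+n = m∸n≢0⇒n<m (m>n⇒m∸n≢0 (s≤s c'≤n) ∘ trans (sym eq))

flipWith-injective : ∀ P {x y} → ht₁ y ≤ P (src y) × ht₂ y ≤ P (tgt y) → flipWith P x ≡ flipWith P y → x ≡ y
flipWith-injective P {a , b , c , d} {a' , b' , c' , d'} (c'≤ , d'≤) eq with cong src eq | cong tgt eq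
... | refl | refl = cong₂ (λ u v → (a , b , u , v))
  (1+n∸-injective (P a) c c' c'≤ (cong ht₁ eq)) (1+n∸-injective (P b) d d' d'≤ (cong ht₂ eq))

sameSet-flip : ∀ P X Y D' → Y ↭ map (flipWith P) X → HeightsBoundedBy P D' →
  sameSet Y (map (flipWith P) D') ≡ sameSet X D'
sameSet-flip P X Y D' Y↭ D'-bounded =
  T⇔T⇒≡ (sameSet-complete X D' ∘ unflip ∘ sameSet-sound Y (map φ D'))
        (sameSet-complete Y (map φ D') ∘ reflip ∘ sameSet-sound X D')
  where
  φ : Edge → Edge
  φ = flipWith P
  injective : ∀ {x y} → y ∈ D' → φ x ≡ φ y → x ≡ y
  injective y∈ = flipWith-injective P (D'-bounded _ y∈)
  unflip : Y ∼[ set ] map φ D' → X ∼[ set ] D'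
  unflip Y∼ = mk⇔
    (λ x∈ → let (y , y∈ , φx≡φy) = ∈-map⁻ φ (Equivalence.to Y∼ (↭ₚ.∈-resp-↭ (↭-sym Y↭) (∈-map⁺ φ x∈)))
            in subst (_∈ D') (sym (injective y∈ φx≡φy)) y∈)
    (λ y∈ → let (x , x∈ , φy≡φx) = ∈-map⁻ φ (↭ₚ.∈-resp-↭ Y↭ (Equivalence.from Y∼ (∈-map⁺ φ y∈)))
            in subst (_∈ X) (injective y∈ (sym φy≡φx)) x∈)
  reflip : X ∼[ set ] D' → Y ∼[ set ] map φ D'
  reflip X∼ = mk⇔
    (λ e∈ → let (x , x∈ , e≡φx) = ∈-map⁻ φ (↭ₚ.∈-resp-↭ Y↭ e∈)
            in subst (_∈ map φ D') (sym e≡φx) (∈-map⁺ φ (Equivalence.to X∼ x∈)))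
    (λ e∈ → let (y , y∈ , e≡φy) = ∈-map⁻ φ e∈
            in ↭ₚ.∈-resp-↭ (↭-sym Y↭) (subst (_∈ map φ X) (sym e≡φy) (∈-map⁺ φ (Equivalence.from X∼ y∈))))

-- Reversing colourings

all-↭ : {A : Set} (g : A → Bool) → ∀ {xs ys} → xs ↭ ys → all g xs ≡ all g ys
all-↭ g π = T⇔T⇒≡ (all⁻ g ∘ ↭ₚ.All-resp-↭ π ∘ all⁺ g _) (all⁻ g ∘ ↭ₚ.All-resp-↭ (↭-sym π) ∘ all⁺ g _)

any-reverseColour : ∀ ℓ k α → All (InOneTo ℓ) α → InOneTo ℓ k →
  any (_≡ᵇ k) (map (reverseColour ℓ) α) ≡ any (_≡ᵇ reverseColour ℓ k) α
any-reverseColour ℓ k [] _ _ = refl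
any-reverseColour ℓ k (c ∷ α) (c-in ∷ α-in) k-in =
  cong₂ _∨_ (reverseColour-≡ᵇ ℓ c k c-in k-in) (any-reverseColour ℓ k α α-in k-in)

isOnto-reverse : ∀ ℓ α → All (InOneTo ℓ) α → isOnto ℓ (map (reverseColour ℓ) α) ≡ isOnto ℓ α
isOnto-reverse ℓ α α-in = begin
  all (λ k → any (_≡ᵇ k) (map (reverseColour ℓ) α)) (oneTo ℓ)
    ≡⟨ cong and (Listₚ.map-cong-local (tabulate (λ {k} → any-reverseColour ℓ k α α-in ∘ ∈oneTo⇒InOneTo ℓ k))) ⟩
  all (hit ∘ reverseColour ℓ) (oneTo ℓ)       ≡⟨ cong and (Listₚ.map-∘ (oneTo ℓ)) ⟩
  all hit (map (reverseColour ℓ) (oneTo ℓ))   ≡⟨ cong (all hit) (map-reverseColour-oneTo ℓ) ⟩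
  all hit (reverse (oneTo ℓ))                 ≡⟨ all-↭ hit (↭ₚ.↭-reverse (oneTo ℓ)) ⟩
  isOnto ℓ α                                  ∎
  where
  open ≡-Reasoning
  hit : ℕ → Bool
  hit k = any (_≡ᵇ k) α

colourings-shape : ∀ ℓ m α → α ∈ colourings ℓ m → length α ≡ m × All (InOneTo ℓ) α
colourings-shape ℓ zero .[] (here refl) = refl , []
colourings-shape ℓ (suc m) α α∈
  with xs , α∈xs , xs∈ ← ∈-concat⁻′ (map (λ c → map (c ∷_) (colourings ℓ m)) (oneTo ℓ)) α∈
  with c , c∈ , refl ← ∈-map⁻ (λ c → map (c ∷_) (colourings ℓ m)) xs∈
  with β , β∈ , refl ← ∈-map⁻ (c ∷_) α∈xs
  with |β|≡m , β-in ← colourings-shape ℓ m β β∈ = cong suc |β|≡m , ∈oneTo⇒InOneTo ℓ c c∈ ∷ β-in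

concat-map-↭ : {A B : Set} (g h : A → List B) → ∀ xs → (∀ x → g x ↭ h x) → concat (map g xs) ↭ concat (map h xs)
concat-map-↭ g h [] _ = ↭-refl
concat-map-↭ g h (x ∷ xs) g↭h = ↭ₚ.++⁺ (g↭h x) (concat-map-↭ g h xs g↭h)

concat-reverse-↭ : {A : Set} → ∀ (xss : List (List A)) → concat (reverse xss) ↭ concat xss
concat-reverse-↭ [] = ↭-refl
concat-reverse-↭ (xs ∷ xss) = begin
  concat (reverse (xs ∷ xss))       ≡⟨ cong concat (Listₚ.unfold-reverse xs xss) ⟩
  concat (reverse xss ++ xs ∷ [])   ≡⟨ Listₚ.concat-++ (reverse xss) (xs ∷ []) ⟨
  concat (reverse xss) ++ xs ++ []  ↭⟨ ↭ₚ.++⁺ (concat-reverse-↭ xss) (↭-reflexive (Listₚ.++-identityʳ xs)) ⟩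
  concat xss ++ xs                  ↭⟨ ↭ₚ.++-comm (concat xss) xs ⟩
  concat (xs ∷ xss)                 ∎
  where open PermutationReasoning

colourings-reverse : ∀ ℓ m → map (map (reverseColour ℓ)) (colourings ℓ m) ↭ colourings ℓ m
colourings-reverse ℓ zero = ↭-refl
colourings-reverse ℓ (suc m) = begin
  map (map (reverseColour ℓ)) (concat (map prefix (oneTo ℓ)))
    ≡⟨ Listₚ.concat-map (map prefix (oneTo ℓ)) ⟨
  concat (map (map (map (reverseColour ℓ))) (map prefix (oneTo ℓ)))
    ≡⟨ cong concat (Listₚ.map-∘ (oneTo ℓ)) ⟨
  concat (map (map (map (reverseColour ℓ)) ∘ prefix) (oneTo ℓ))
    ↭⟨ concat-map-↭ _ (prefix ∘ reverseColour ℓ) (oneTo ℓ) reversed-prefix ⟩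
  concat (map (prefix ∘ reverseColour ℓ) (oneTo ℓ))
    ≡⟨ cong concat (Listₚ.map-∘ (oneTo ℓ)) ⟩
  concat (map prefix (map (reverseColour ℓ) (oneTo ℓ)))
    ≡⟨ cong (concat ∘ map prefix) (map-reverseColour-oneTo ℓ) ⟩
  concat (map prefix (reverse (oneTo ℓ)))
    ≡⟨ cong concat (Listₚ.reverse-map prefix (oneTo ℓ)) ⟩
  concat (reverse (map prefix (oneTo ℓ)))
    ↭⟨ concat-reverse-↭ (map prefix (oneTo ℓ)) ⟩
  concat (map prefix (oneTo ℓ)) ∎
  where
  open PermutationReasoning
  prefix : ℕ → List (List ℕ)
  prefix c = map (c ∷_) (colourings ℓ m)
  reversed-prefix : ∀ c → map (map (reverseColour ℓ)) (prefix c) ↭ prefix (reverseColour ℓ c)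
  reversed-prefix c =
    ↭-trans (↭-reflexive (trans (sym (Listₚ.map-∘ (colourings ℓ m))) (Listₚ.map-∘ (colourings ℓ m))))
            (↭ₚ.map⁺ (reverseColour ℓ c ∷_) (colourings-reverse ℓ m))

reconstructs : ℕ → Diagram → Diagram → List ℕ → Bool
reconstructs ℓ D D' α = isOnto ℓ α ∧ sameSet (reconstruct ℓ D α) D'

reconstructs-flip : ∀ {ℓ D D' α} → WellLabelled D → HeightsBoundedBy (pegSize D) D' →
  α ∈ colourings ℓ (length D) →
  reconstructs ℓ (flip D) (map (flipWith (pegSize D)) D') (map (reverseColour ℓ) α) ≡ reconstructs ℓ D D' α
reconstructs-flip {ℓ} {D} {D'} {α} wl D'-bounded α∈
  with |α|≡|D| , α-in ← colourings-shape ℓ (length D) α α∈ =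
  cong₂ _∧_ (isOnto-reverse ℓ α α-in)
    (sameSet-flip (pegSize D) (reconstruct ℓ D α) _ D' (reconstruct-flip wl |α|≡|D| α-in) D'-bounded)

f-flip : ∀ {D D'} → WellLabelled D → HeightsBoundedBy (pegSize D) D' →
  ∀ ℓ → f D D' ℓ ≡ f (flip D) (map (flipWith (pegSize D)) D') ℓ
f-flip {D} {D'} wl D'-bounded ℓ = begin
  count (reconstructs ℓ D D') (colourings ℓ (length D))
    ≡⟨ count-cong _ _ (colourings ℓ (length D)) (λ α α∈ → sym (reconstructs-flip wl D'-bounded α∈)) ⟩
  count (reconstructs ℓ (flip D) D'' ∘ map (reverseColour ℓ)) (colourings ℓ (length D))
    ≡⟨ count-map (reconstructs ℓ (flip D) D'') (map (reverseColour ℓ)) (colourings ℓ (length D)) ⟨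
  count (reconstructs ℓ (flip D) D'') (map (map (reverseColour ℓ)) (colourings ℓ (length D)))
    ≡⟨ count-↭ (reconstructs ℓ (flip D) D'') (colourings-reverse ℓ (length D)) ⟩
  count (reconstructs ℓ (flip D) D'') (colourings ℓ (length D))
    ≡⟨ cong (count (reconstructs ℓ (flip D) D'') ∘ colourings ℓ) (Listₚ.length-map (flipWith (pegSize D)) D) ⟨
  f (flip D) D'' ℓ ∎
  where
  open ≡-Reasoning
  D'' : Diagram
  D'' = map (flipWith (pegSize D)) D'

wellLabelled⇒bounded : ∀ {D} → WellLabelled D → HeightsBounded D
wellLabelled⇒bounded {D} wl e e∈ = proj₂ (height-range (src e) (ht₁ e) (ht₁∈heightsOn D e e∈)) ,
                                   proj₂ (height-range (tgt e) (ht₂ e) (ht₂∈heightsOn D e e∈))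
  where open WellLabelled wl

HeightsBoundedBy-cong : ∀ {P Q R} → (∀ a → P a ≡ Q a) → HeightsBoundedBy P R → HeightsBoundedBy Q R
HeightsBoundedBy-cong P≡Q bounded e e∈ =
  let (ht₁≤ , ht₂≤) = bounded e e∈ in subst (ht₁ e ≤_) (P≡Q (src e)) ht₁≤ , subst (ht₂ e ≤_) (P≡Q (tgt e)) ht₂≤

mainTheorem5 : (n : ℕ) (D₀ D D' : Diagram) → IsWebDiagram n D₀
    → InWebWorld n D₀ D → InWebWorld n D₀ D'
    → (ℓ : ℕ) → webMatrixCoeff D D' ℓ ≡ webMatrixCoeff (flip D) (flip D') ℓ
mainTheorem5 n D₀ D D' _ D∈W D'∈W zero = refl
mainTheorem5 n D₀ D D' _ D∈W D'∈W (suc ℓ) = begin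
  f D D' (suc ℓ)
    ≡⟨ f-flip (webDiagram⇒wellLabelled (proj₁ D∈W)) D'-bounded (suc ℓ) ⟩
  f (flip D) (map (flipWith (pegSize D)) D') (suc ℓ)
    ≡⟨ cong (λ X → f (flip D) X (suc ℓ)) (flip-pegSize D' same-sizes) ⟨
  f (flip D) (flip D') (suc ℓ) ∎
  where
  open ≡-Reasoning
  same-sizes : ∀ a → p a D' ≡ p a D
  same-sizes a = trans (p-webWorld D'∈W a) (sym (p-webWorld D∈W a))
  D'-bounded : HeightsBoundedBy (pegSize D) D'
  D'-bounded = HeightsBoundedBy-cong same-sizes (wellLabelled⇒bounded (webDiagram⇒wellLabelled (proj₁ D'∈W)))
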